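{- Let $P$ be a Dyck path, and for $h\ge0$ let $d_h(P)$ be the number of Dyck paths of semilength $h$ avoiding $P$. Then for every $n\ge 0$, $$s_n(P)=\sum_{h=0}^{n}\binom{n+h}{n-h}\, d_h(P).$$
   Context: Schröder and Dyck paths: - A Schröder path is a finite word over $\{U,D,H_2\}$, viewed as a lattice path from $(0,0)$ with steps $U=(1,1)$, $D=(1,-1)$, $H_2=(2,0)$, ending on the $x$-axis and never going below it. The empty path is allowed. - Its semilength is (number of $U$'s) + (number of $H_2$'s). - A Dyck path is a Schröder path with no $H_2$ step. Pattern order and avoidance: - $P\le Q$ if $P$ occurs as a (not necessarily contiguous) subword of $Q$. - $Q$ avoids $P$ if $P\not\le Q$. - $s_n(P)$ denotes the number of Schröder paths of semilength $n$ avoiding $P$. -}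

module Defs where

open import Data.Nat using (ℕ; zero; suc; _+_; _*_; _≟_)
open import Data.Nat.Combinatorics using (_C_)
open import Data.Maybe using (Maybe; just; nothing)
open import Data.List using (List; []; _∷_; map; concatMap; filter; length; upTo)
open import Data.Product using (_×_)
open import Relation.Nullary using (Dec; yes; no; ¬_; _×-dec_; ¬?)
open import Relation.Binary.PropositionalEquality using (_≡_; refl)
open import Relation.Binary.Definitions using (DecidableEquality)
open import Data.Maybe.Properties using (≡-dec)

-- Steps: U = (1,1), D = (1,-1), H2 = (2,0)
data Step : Set where
  U D H2 : Step

_≟S_ : DecidableEquality Step
U ≟S U = yes refl
U ≟S D = no λ ()
U ≟S H2 = no λ ()
D ≟S U = no λ ()
D ≟S D = yes refl
D ≟S H2 = no λ ()
H2 ≟S U = no λ ()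
H2 ≟S D = no λ ()
H2 ≟S H2 = yes refl

Word : Set
Word = List Step

open import Data.List.Relation.Binary.Sublist.DecPropositional _≟S_
  using (_⊆_; _⊆?_) public

_≼_ : Word → Word → Set
P ≼ Q = P ⊆ Q

Avoids : Word → Word → Set
Avoids Q P = ¬ (P ≼ Q)

walk : ℕ → Word → Maybe ℕ
walk h [] = just h
walk h (U ∷ w) = walk (suc h) w
walk zero (D ∷ w) = nothing
walk (suc h) (D ∷ w) = walk h w
walk h (H2 ∷ w) = walk h w

IsSchroder : Word → Set
IsSchroder w = walk 0 w ≡ just 0

NoH2 : Word → Set
NoH2 [] = ⊤' where open import Data.Unit using () renaming (⊤ to ⊤')
NoH2 (H2 ∷ w) = ⊥' where open import Data.Empty using () renaming (⊥ to ⊥')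
NoH2 (_ ∷ w) = NoH2 w

IsDyck : Word → Set
IsDyck w = IsSchroder w × NoH2 w

semilength : Word → ℕ
semilength [] = 0
semilength (U ∷ w) = suc (semilength w)
semilength (D ∷ w) = semilength w
semilength (H2 ∷ w) = suc (semilength w)

isSchroder? : ∀ w → Dec (IsSchroder w)
isSchroder? w = ≡-dec _≟_ (walk 0 w) (just 0)

noH2? : ∀ w → Dec (NoH2 w)
noH2? [] = yes _
noH2? (U ∷ w) = noH2? w
noH2? (D ∷ w) = noH2? w
noH2? (H2 ∷ w) = no λ ()

isDyck? : ∀ w → Dec (IsDyck w)
isDyck? w = isSchroder? w ×-dec noH2? w

avoids? : ∀ Q P → Dec (Avoids Q P)
avoids? Q P = ¬? (P ⊆? Q)

wordsOfLength : ℕ → List Word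
wordsOfLength zero = [] ∷ []
wordsOfLength (suc k) = concatMap (λ w → (U ∷ w) ∷ (D ∷ w) ∷ (H2 ∷ w) ∷ []) (wordsOfLength k)

-- all words of length ≤ k (each exactly once); every word of semilength n has length ≤ 2n
wordsUpTo : ℕ → List Word
wordsUpTo k = concatMap wordsOfLength (upTo (suc k))

s : ℕ → Word → ℕ
s n P = length (filter (λ w → isSchroder? w ×-dec (semilength w ≟ n) ×-dec avoids? w P)
                       (wordsUpTo (2 * n)))

d : ℕ → Word → ℕ
d h P = length (filter (λ w → isDyck? w ×-dec (semilength w ≟ h) ×-dec avoids? w P)
                       (wordsUpTo (2 * h)))

-- Deleting the H2 steps of a Schröder path of semilength n with k steps H2 leaves a Dyck path
-- of semilength h = n − k, and the path has n + h steps, so it is recovered from that Dyck path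
-- together with the C(n + h, k) choices of positions of its H2 steps. Since P has no H2 step,
-- a Schröder path avoids P exactly when the Dyck path left after deleting its H2 steps does.
module Submission where

open import Defs
open import Data.Nat using (ℕ; zero; suc; _+_; _*_; _∸_; _≤_; _<_; z≤n; s≤s; _≟_)
open import Data.Nat.Properties
open import Data.Nat.Combinatorics using (_C_; nCn≡1; nCk+nC[k+1]≡[n+1]C[k+1])
open import Data.Nat.ListAction using (sum)
open import Data.Nat.ListAction.Properties using (sum-++)
open import Data.List using (List; []; _∷_; _++_; length; map; filter; concatMap; applyUpTo; upTo)
open import Data.List.Properties using (map-++; map-upTo)
open import Data.List.Relation.Binary.Sublist.Heterogeneous.Core using (_∷ʳ_; _∷_)
open import Data.Bool using (true; false; if_then_else_)
open import Data.Maybe using (just)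
open import Data.Product using (_×_; _,_)
open import Function using (_∘_)
open import Relation.Nullary using (Dec; yes; no; ¬_; does; _×-dec_; contradiction)
open import Relation.Binary.PropositionalEquality
  using (_≡_; refl; sym; trans; cong; cong₂; subst; subst₂; module ≡-Reasoning)
open import Algebra.Properties.CommutativeSemigroup +-commutativeSemigroup using (interchange)
open ≡-Reasoning

𝟙 : ∀ {A : Set} → Dec A → ℕ
𝟙 a = if does a then 1 else 0

𝟙-× : ∀ {A B : Set} (a : Dec A) (b : Dec B) → 𝟙 (a ×-dec b) ≡ 𝟙 a * 𝟙 b
𝟙-× (yes _) (yes _) = refl
𝟙-× (yes _) (no _)  = refl
𝟙-× (no _)  _       = refl

𝟙-⇔ : ∀ {A B : Set} → (A → B) → (B → A) → (a : Dec A) (b : Dec B) → 𝟙 a ≡ 𝟙 b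
𝟙-⇔ f g (yes _) (yes _) = refl
𝟙-⇔ f g (yes x) (no ¬y) = contradiction (f x) ¬y
𝟙-⇔ f g (no ¬x) (yes y) = contradiction (g y) ¬x
𝟙-⇔ f g (no _)  (no _)  = refl

𝟙-¬ : ∀ {A : Set} → ¬ A → (a : Dec A) → 𝟙 a ≡ 0
𝟙-¬ ¬x (yes x) = contradiction x ¬x
𝟙-¬ ¬x (no _)  = refl

length-filter≡sum-𝟙 : ∀ {A : Set} {P : A → Set} (P? : ∀ x → Dec (P x)) (xs : List A) →
  length (filter P? xs) ≡ sum (map (𝟙 ∘ P?) xs)
length-filter≡sum-𝟙 P? [] = refl
length-filter≡sum-𝟙 P? (x ∷ xs) with does (P? x)
... | true  = cong suc (length-filter≡sum-𝟙 P? xs)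
... | false = length-filter≡sum-𝟙 P? xs

sum-map-+ : ∀ {A : Set} (f g : A → ℕ) (xs : List A) →
  sum (map (λ x → f x + g x) xs) ≡ sum (map f xs) + sum (map g xs)
sum-map-+ f g [] = refl
sum-map-+ f g (x ∷ xs) =
  trans (cong (f x + g x +_) (sum-map-+ f g xs)) (interchange (f x) (g x) _ _)

sum-map-concatMap : ∀ {A B : Set} (F : B → ℕ) (g : A → List B) (xs : List A) →
  sum (map F (concatMap g xs)) ≡ sum (map (λ x → sum (map F (g x))) xs)
sum-map-concatMap F g [] = refl
sum-map-concatMap F g (x ∷ xs) = begin
  sum (map F (g x ++ concatMap g xs))
    ≡⟨ cong sum (map-++ F (g x) (concatMap g xs)) ⟩
  sum (map F (g x) ++ map F (concatMap g xs))
    ≡⟨ sum-++ (map F (g x)) _ ⟩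
  sum (map F (g x)) + sum (map F (concatMap g xs))
    ≡⟨ cong (sum (map F (g x)) +_) (sum-map-concatMap F g xs) ⟩
  sum (map F (g x)) + sum (map (λ y → sum (map F (g y))) xs) ∎

sum-applyUpTo-cong : ∀ m {f g : ℕ → ℕ} → (∀ i → i < m → f i ≡ g i) →
  sum (applyUpTo f m) ≡ sum (applyUpTo g m)
sum-applyUpTo-cong zero    f≡g = refl
sum-applyUpTo-cong (suc m) f≡g =
  cong₂ _+_ (f≡g 0 (s≤s z≤n)) (sum-applyUpTo-cong m (λ i i<m → f≡g (suc i) (s≤s i<m)))

sum-applyUpTo-+ : ∀ a m (f : ℕ → ℕ) → (∀ i → i < a → f i ≡ 0) →
  sum (applyUpTo f (a + m)) ≡ sum (applyUpTo (λ i → f (a + i)) m)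
sum-applyUpTo-+ zero    m f f≡0 = refl
sum-applyUpTo-+ (suc a) m f f≡0 =
  trans (cong (_+ sum (applyUpTo (f ∘ suc) (a + m))) (f≡0 0 (s≤s z≤n)))
        (sum-applyUpTo-+ a m (f ∘ suc) (λ i i<a → f≡0 (suc i) (s≤s i<a)))

sumWords : ℕ → (Word → ℕ) → ℕ
sumWords L F = sum (map F (wordsOfLength L))

sumWords-suc : ∀ L F → sumWords (suc L) F ≡
  sumWords L (λ w → F (U ∷ w) + (F (D ∷ w) + (F (H2 ∷ w) + 0)))
sumWords-suc L F = sum-map-concatMap F _ (wordsOfLength L)

sumWords-+ : ∀ L F G → sumWords L (λ w → F w + G w) ≡ sumWords L F + sumWords L G
sumWords-+ L F G = sum-map-+ F G (wordsOfLength L)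

sumWords-cong : ∀ L {F G} → (∀ w → length w ≡ L → F w ≡ G w) → sumWords L F ≡ sumWords L G
sumWords-cong zero    F≡G = cong (_+ 0) (F≡G [] refl)
sumWords-cong (suc L) {F} {G} F≡G = begin
  sumWords (suc L) F                   ≡⟨ sumWords-suc L F ⟩
  sumWords L (λ w → F (U ∷ w) + _)     ≡⟨ sumWords-cong L extensions-agree ⟩
  sumWords L (λ w → G (U ∷ w) + _)     ≡⟨ sumWords-suc L G ⟨
  sumWords (suc L) G                   ∎
  where
  extensions-agree : ∀ w → length w ≡ L →
    F (U ∷ w) + (F (D ∷ w) + (F (H2 ∷ w) + 0)) ≡ G (U ∷ w) + (G (D ∷ w) + (G (H2 ∷ w) + 0))
  extensions-agree w refl =
    cong₂ _+_ (F≡G _ refl) (cong₂ _+_ (F≡G _ refl) (cong (_+ 0) (F≡G _ refl)))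

sumWords-vanish : ∀ L {F} → (∀ w → length w ≡ L → F w ≡ 0) → sumWords L F ≡ 0
sumWords-vanish L F≡0 = trans (sumWords-cong L F≡0) (sum-zeros (wordsOfLength L))
  where
  sum-zeros : ∀ (ws : List Word) → sum (map (λ _ → 0) ws) ≡ 0
  sum-zeros []       = refl
  sum-zeros (_ ∷ ws) = sum-zeros ws

count-wordsUpTo : ∀ {Q : Word → Set} (Q? : ∀ w → Dec (Q w)) k →
  length (filter Q? (wordsUpTo k)) ≡ sum (applyUpTo (λ L → sumWords L (𝟙 ∘ Q?)) (suc k))
count-wordsUpTo Q? k = begin
  length (filter Q? (wordsUpTo k))
    ≡⟨ length-filter≡sum-𝟙 Q? (wordsUpTo k) ⟩
  sum (map (𝟙 ∘ Q?) (wordsUpTo k))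
    ≡⟨ sum-map-concatMap (𝟙 ∘ Q?) wordsOfLength (upTo (suc k)) ⟩
  sum (map (λ L → sumWords L (𝟙 ∘ Q?)) (upTo (suc k)))
    ≡⟨ cong sum (map-upTo _ (suc k)) ⟩
  sum (applyUpTo (λ L → sumWords L (𝟙 ∘ Q?)) (suc k)) ∎

eraseH2 : Word → Word
eraseH2 []       = []
eraseH2 (U ∷ w)  = U ∷ eraseH2 w
eraseH2 (D ∷ w)  = D ∷ eraseH2 w
eraseH2 (H2 ∷ w) = eraseH2 w

countH2 : Word → ℕ
countH2 []       = 0
countH2 (U ∷ w)  = countH2 w
countH2 (D ∷ w)  = countH2 w
countH2 (H2 ∷ w) = suc (countH2 w)

noH2-eraseH2 : ∀ w → NoH2 (eraseH2 w)
noH2-eraseH2 []       = _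
noH2-eraseH2 (U ∷ w)  = noH2-eraseH2 w
noH2-eraseH2 (D ∷ w)  = noH2-eraseH2 w
noH2-eraseH2 (H2 ∷ w) = noH2-eraseH2 w

walk-eraseH2 : ∀ a w → walk a (eraseH2 w) ≡ walk a w
walk-eraseH2 a       []       = refl
walk-eraseH2 a       (U ∷ w)  = walk-eraseH2 (suc a) w
walk-eraseH2 zero    (D ∷ w)  = refl
walk-eraseH2 (suc a) (D ∷ w)  = walk-eraseH2 a w
walk-eraseH2 a       (H2 ∷ w) = walk-eraseH2 a w

semilength-eraseH2 : ∀ w → semilength w ≡ semilength (eraseH2 w) + countH2 w
semilength-eraseH2 []       = refl
semilength-eraseH2 (U ∷ w)  = cong suc (semilength-eraseH2 w)
semilength-eraseH2 (D ∷ w)  = semilength-eraseH2 w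
semilength-eraseH2 (H2 ∷ w) = trans (cong suc (semilength-eraseH2 w)) (sym (+-suc _ _))

length-eraseH2 : ∀ w → length w ≡ length (eraseH2 w) + countH2 w
length-eraseH2 []       = refl
length-eraseH2 (U ∷ w)  = cong suc (length-eraseH2 w)
length-eraseH2 (D ∷ w)  = cong suc (length-eraseH2 w)
length-eraseH2 (H2 ∷ w) = trans (cong suc (length-eraseH2 w)) (sym (+-suc _ _))

⊆-eraseH2⁺ : ∀ {P} w → P ⊆ eraseH2 w → P ⊆ w
⊆-eraseH2⁺ []       P⊆ = P⊆
⊆-eraseH2⁺ (U ∷ w)  (.U ∷ʳ P⊆) = U ∷ʳ ⊆-eraseH2⁺ w P⊆
⊆-eraseH2⁺ (U ∷ w)  (eq ∷ P⊆)  = eq ∷ ⊆-eraseH2⁺ w P⊆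
⊆-eraseH2⁺ (D ∷ w)  (.D ∷ʳ P⊆) = D ∷ʳ ⊆-eraseH2⁺ w P⊆
⊆-eraseH2⁺ (D ∷ w)  (eq ∷ P⊆)  = eq ∷ ⊆-eraseH2⁺ w P⊆
⊆-eraseH2⁺ (H2 ∷ w) P⊆         = H2 ∷ʳ ⊆-eraseH2⁺ w P⊆

⊆-eraseH2⁻ : ∀ {P} w → NoH2 P → P ⊆ w → P ⊆ eraseH2 w
⊆-eraseH2⁻ []       _    P⊆            = P⊆
⊆-eraseH2⁻ (U ∷ w)  noH2 (.U ∷ʳ P⊆)    = U ∷ʳ ⊆-eraseH2⁻ w noH2 P⊆
⊆-eraseH2⁻ (U ∷ w)  noH2 (refl ∷ P⊆)   = refl ∷ ⊆-eraseH2⁻ w noH2 P⊆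
⊆-eraseH2⁻ (D ∷ w)  noH2 (.D ∷ʳ P⊆)    = D ∷ʳ ⊆-eraseH2⁻ w noH2 P⊆
⊆-eraseH2⁻ (D ∷ w)  noH2 (refl ∷ P⊆)   = refl ∷ ⊆-eraseH2⁻ w noH2 P⊆
⊆-eraseH2⁻ (H2 ∷ w) noH2 (.H2 ∷ʳ P⊆)   = ⊆-eraseH2⁻ w noH2 P⊆
⊆-eraseH2⁻ (H2 ∷ w) ()   (refl ∷ P⊆)

sumH2Free : ℕ → (Word → ℕ) → ℕ
sumH2Free m G = sumWords m (λ v → 𝟙 (noH2? v) * G v)

sumEraseH2 : ℕ → ℕ → (Word → ℕ) → ℕ
sumEraseH2 L k G = sumWords L (λ w → 𝟙 (countH2 w ≟ k) * G (eraseH2 w))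

sumH2Free-suc : ∀ m G →
  sumH2Free (suc m) G ≡ sumH2Free m (G ∘ (U ∷_)) + sumH2Free m (G ∘ (D ∷_))
sumH2Free-suc m G = begin
  sumH2Free (suc m) G
    ≡⟨ sumWords-suc m _ ⟩
  sumWords m (λ v → 𝟙 (noH2? v) * G (U ∷ v) + (𝟙 (noH2? v) * G (D ∷ v) + 0))
    ≡⟨ sumWords-cong m (λ v _ → cong (𝟙 (noH2? v) * G (U ∷ v) +_) (+-identityʳ _)) ⟩
  sumWords m (λ v → 𝟙 (noH2? v) * G (U ∷ v) + 𝟙 (noH2? v) * G (D ∷ v))
    ≡⟨ sumWords-+ m _ _ ⟩
  sumH2Free m (G ∘ (U ∷_)) + sumH2Free m (G ∘ (D ∷_)) ∎

sumEraseH2-suc-zero : ∀ L G →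
  sumEraseH2 (suc L) 0 G ≡ sumEraseH2 L 0 (G ∘ (U ∷_)) + sumEraseH2 L 0 (G ∘ (D ∷_))
sumEraseH2-suc-zero L G = begin
  sumEraseH2 (suc L) 0 G
    ≡⟨ sumWords-suc L _ ⟩
  sumWords L (λ w → up w + (down w + 0))
    ≡⟨ sumWords-cong L (λ w _ → cong (up w +_) (+-identityʳ _)) ⟩
  sumWords L (λ w → up w + down w)
    ≡⟨ sumWords-+ L up down ⟩
  sumEraseH2 L 0 (G ∘ (U ∷_)) + sumEraseH2 L 0 (G ∘ (D ∷_)) ∎
  where
  up down : Word → ℕ
  up   w = 𝟙 (countH2 w ≟ 0) * G (U ∷ eraseH2 w)
  down w = 𝟙 (countH2 w ≟ 0) * G (D ∷ eraseH2 w)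

sumEraseH2-suc-suc : ∀ L k G → sumEraseH2 (suc L) (suc k) G ≡
  sumEraseH2 L (suc k) (G ∘ (U ∷_)) + sumEraseH2 L (suc k) (G ∘ (D ∷_)) + sumEraseH2 L k G
sumEraseH2-suc-suc L k G = begin
  sumEraseH2 (suc L) (suc k) G
    ≡⟨ sumWords-suc L _ ⟩
  sumWords L (λ w → up w + (down w + (flat w + 0)))
    ≡⟨ sumWords-cong L (λ w _ → regroup (up w) (down w) (flat w)) ⟩
  sumWords L (λ w → (up w + down w) + flat w)
    ≡⟨ sumWords-+ L _ flat ⟩
  sumWords L (λ w → up w + down w) + sumEraseH2 L k G
    ≡⟨ cong (_+ sumEraseH2 L k G) (sumWords-+ L up down) ⟩
  sumEraseH2 L (suc k) (G ∘ (U ∷_)) + sumEraseH2 L (suc k) (G ∘ (D ∷_)) + sumEraseH2 L k G ∎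
  where
  up down flat : Word → ℕ
  up   w = 𝟙 (countH2 w ≟ suc k) * G (U ∷ eraseH2 w)
  down w = 𝟙 (countH2 w ≟ suc k) * G (D ∷ eraseH2 w)
  flat w = 𝟙 (countH2 w ≟ k) * G (eraseH2 w)
  regroup : ∀ a b c → a + (b + (c + 0)) ≡ (a + b) + c
  regroup a b c = trans (cong (λ x → a + (b + x)) (+-identityʳ c)) (sym (+-assoc a b c))

sumEraseH2-< : ∀ L k G → L < k → sumEraseH2 L k G ≡ 0
sumEraseH2-< zero    (suc k) G _         = refl
sumEraseH2-< (suc L) (suc k) G (s≤s L<k) = begin
  sumEraseH2 (suc L) (suc k) G
    ≡⟨ sumEraseH2-suc-suc L k G ⟩
  sumEraseH2 L (suc k) (G ∘ (U ∷_)) + sumEraseH2 L (suc k) (G ∘ (D ∷_)) + sumEraseH2 L k G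
    ≡⟨ cong₂ _+_ (cong₂ _+_ (sumEraseH2-< L (suc k) (G ∘ (U ∷_)) (m<n⇒m<1+n L<k))
                            (sumEraseH2-< L (suc k) (G ∘ (D ∷_)) (m<n⇒m<1+n L<k)))
                 (sumEraseH2-< L k G L<k) ⟩
  0 ∎

-- The words of length m + k with k steps H2 are the shuffles of an H2-free word of length m
-- with H2ᵏ; the recursion on the first step is Pascal's rule.
sumEraseH2≡C*sumH2Free : ∀ k m G → sumEraseH2 (m + k) k G ≡ ((m + k) C k) * sumH2Free m G
sumEraseH2≡C*sumH2Free zero zero G = sym (*-identityˡ _)
sumEraseH2≡C*sumH2Free zero (suc m) G = begin
  sumEraseH2 (suc (m + 0)) 0 G
    ≡⟨ sumEraseH2-suc-zero (m + 0) G ⟩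
  sumEraseH2 (m + 0) 0 (G ∘ (U ∷_)) + sumEraseH2 (m + 0) 0 (G ∘ (D ∷_))
    ≡⟨ cong₂ _+_ (sumEraseH2≡C*sumH2Free zero m (G ∘ (U ∷_)))
                 (sumEraseH2≡C*sumH2Free zero m (G ∘ (D ∷_))) ⟩
  1 * sumH2Free m (G ∘ (U ∷_)) + 1 * sumH2Free m (G ∘ (D ∷_))
    ≡⟨ *-distribˡ-+ 1 (sumH2Free m (G ∘ (U ∷_))) (sumH2Free m (G ∘ (D ∷_))) ⟨
  1 * (sumH2Free m (G ∘ (U ∷_)) + sumH2Free m (G ∘ (D ∷_)))
    ≡⟨ cong (1 *_) (sumH2Free-suc m G) ⟨
  1 * sumH2Free (suc m) G ∎
sumEraseH2≡C*sumH2Free (suc k) zero G = begin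
  sumEraseH2 (suc k) (suc k) G
    ≡⟨ sumEraseH2-suc-suc k k G ⟩
  sumEraseH2 k (suc k) (G ∘ (U ∷_)) + sumEraseH2 k (suc k) (G ∘ (D ∷_)) + sumEraseH2 k k G
    ≡⟨ cong₂ _+_ (cong₂ _+_ (sumEraseH2-< k (suc k) (G ∘ (U ∷_)) (n<1+n k))
                            (sumEraseH2-< k (suc k) (G ∘ (D ∷_)) (n<1+n k)))
                 (sumEraseH2≡C*sumH2Free k zero G) ⟩
  (k C k) * sumH2Free 0 G
    ≡⟨ cong (_* sumH2Free 0 G) (trans (nCn≡1 k) (sym (nCn≡1 (suc k)))) ⟩
  (suc k C suc k) * sumH2Free 0 G ∎
sumEraseH2≡C*sumH2Free (suc k) (suc m) G = begin
  sumEraseH2 (suc L) (suc k) G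
    ≡⟨ sumEraseH2-suc-suc L k G ⟩
  sumEraseH2 L (suc k) (G ∘ (U ∷_)) + sumEraseH2 L (suc k) (G ∘ (D ∷_)) + sumEraseH2 L k G
    ≡⟨ cong₂ _+_ (cong₂ _+_ (sumEraseH2≡C*sumH2Free (suc k) m (G ∘ (U ∷_)))
                            (sumEraseH2≡C*sumH2Free (suc k) m (G ∘ (D ∷_))))
                 fewer-H2 ⟩
  (L C suc k) * sumH2Free m (G ∘ (U ∷_)) + (L C suc k) * sumH2Free m (G ∘ (D ∷_))
    + (L C k) * sumH2Free (suc m) G
    ≡⟨ cong (_+ (L C k) * sumH2Free (suc m) G)
            (trans (sym (*-distribˡ-+ (L C suc k) _ _))
                   (cong ((L C suc k) *_) (sym (sumH2Free-suc m G)))) ⟩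
  (L C suc k) * sumH2Free (suc m) G + (L C k) * sumH2Free (suc m) G
    ≡⟨ *-distribʳ-+ (sumH2Free (suc m) G) (L C suc k) (L C k) ⟨
  ((L C suc k) + (L C k)) * sumH2Free (suc m) G
    ≡⟨ cong (_* sumH2Free (suc m) G)
            (trans (+-comm (L C suc k) (L C k)) (nCk+nC[k+1]≡[n+1]C[k+1] L k)) ⟩
  (suc L C suc k) * sumH2Free (suc m) G ∎
  where
  L = m + suc k
  fewer-H2 : sumEraseH2 L k G ≡ (L C k) * sumH2Free (suc m) G
  fewer-H2 = subst (λ x → sumEraseH2 x k G ≡ (x C k) * sumH2Free (suc m) G)
                   (sym (+-suc m k)) (sumEraseH2≡C*sumH2Free k (suc m) G)

semilength≤length : ∀ w → semilength w ≤ length w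
semilength≤length []       = z≤n
semilength≤length (U ∷ w)  = s≤s (semilength≤length w)
semilength≤length (D ∷ w)  = m≤n⇒m≤1+n (semilength≤length w)
semilength≤length (H2 ∷ w) = s≤s (semilength≤length w)

length-walk : ∀ a b v → NoH2 v → walk a v ≡ just b →
  length v + b ≡ semilength v + semilength v + a
length-walk a b []      _    refl = refl
length-walk a b (U ∷ v) noH2 ends = begin
  suc (length v + b)                              ≡⟨ cong suc (length-walk (suc a) b v noH2 ends) ⟩
  suc (semilength v + semilength v + suc a)       ≡⟨ cong suc (+-suc _ a) ⟩
  suc (suc (semilength v + semilength v + a))     ≡⟨ cong (λ x → suc (x + a)) (+-suc _ _) ⟨
  suc (semilength v) + suc (semilength v) + a     ∎
length-walk (suc a) b (D ∷ v) noH2 ends =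
  trans (cong suc (length-walk a b v noH2 ends)) (sym (+-suc _ a))

length-dyck : ∀ v → IsDyck v → length v ≡ semilength v + semilength v
length-dyck v (schroder , noH2) = begin
  length v                              ≡⟨ +-identityʳ _ ⟨
  length v + 0                          ≡⟨ length-walk 0 0 v noH2 schroder ⟩
  semilength v + semilength v + 0       ≡⟨ +-identityʳ _ ⟩
  semilength v + semilength v           ∎

eraseH2-dyck : ∀ w → IsSchroder w → IsDyck (eraseH2 w)
eraseH2-dyck w schroder = trans (walk-eraseH2 0 w) schroder , noH2-eraseH2 w

length-schroder : ∀ w → IsSchroder w → length w ≡ semilength w + semilength (eraseH2 w)
length-schroder w schroder = begin
  length w                ≡⟨ length-eraseH2 w ⟩
  length (eraseH2 w) + c  ≡⟨ cong (_+ c) (length-dyck (eraseH2 w) (eraseH2-dyck w schroder)) ⟩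
  a + a + c               ≡⟨ +-assoc a a c ⟩
  a + (a + c)             ≡⟨ +-comm a (a + c) ⟩
  (a + c) + a             ≡⟨ cong (_+ a) (semilength-eraseH2 w) ⟨
  semilength w + a        ∎
  where
  a = semilength (eraseH2 w)
  c = countH2 w

AvoidingSchroder : ℕ → Word → Word → Set
AvoidingSchroder n P w = IsSchroder w × semilength w ≡ n × Avoids w P

avoidingSchroder? : ∀ n P w → Dec (AvoidingSchroder n P w)
avoidingSchroder? n P w = isSchroder? w ×-dec (semilength w ≟ n) ×-dec avoids? w P

AvoidingDyck : ℕ → Word → Word → Set
AvoidingDyck h P v = IsDyck v × semilength v ≡ h × Avoids v P

avoidingDyck? : ∀ h P v → Dec (AvoidingDyck h P v)
avoidingDyck? h P v = isDyck? v ×-dec (semilength v ≟ h) ×-dec avoids? v P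

eraseH2-avoidingDyck : ∀ {n h P w} → AvoidingSchroder n P w → length w ≡ n + h →
  countH2 w ≡ n ∸ h × AvoidingDyck h P (eraseH2 w)
eraseH2-avoidingDyck {n} {h} {P} {w} (schroder , refl , avoids) length≡ =
  countH2≡ , eraseH2-dyck w schroder , a≡h , (avoids ∘ ⊆-eraseH2⁺ w)
  where
  a = semilength (eraseH2 w)
  a≡h : a ≡ h
  a≡h = +-cancelˡ-≡ n a h (trans (sym (length-schroder w schroder)) length≡)
  countH2≡ : countH2 w ≡ n ∸ h
  countH2≡ = begin
    countH2 w            ≡⟨ m+n∸m≡n a (countH2 w) ⟨
    a + countH2 w ∸ a    ≡⟨ cong₂ _∸_ (semilength-eraseH2 w) (sym a≡h) ⟨
    n ∸ h                ∎

avoidingDyck-eraseH2 : ∀ {n h P w} → h ≤ n → NoH2 P →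
  countH2 w ≡ n ∸ h × AvoidingDyck h P (eraseH2 w) → AvoidingSchroder n P w
avoidingDyck-eraseH2 {n} {h} {P} {w} h≤n noH2 (countH2≡ , (walks , _) , a≡h , avoids) =
  trans (sym (walk-eraseH2 0 w)) walks , semilength≡ , (avoids ∘ ⊆-eraseH2⁻ w noH2)
  where
  semilength≡ : semilength w ≡ n
  semilength≡ = begin
    semilength w                          ≡⟨ semilength-eraseH2 w ⟩
    semilength (eraseH2 w) + countH2 w    ≡⟨ cong₂ _+_ a≡h countH2≡ ⟩
    h + (n ∸ h)                           ≡⟨ m+[n∸m]≡n h≤n ⟩
    n                                     ∎

sumWords-avoidingSchroder-< : ∀ n P L → L < n → sumWords L (𝟙 ∘ avoidingSchroder? n P) ≡ 0
sumWords-avoidingSchroder-< n P L L<n = sumWords-vanish L λ w length≡ →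
  𝟙-¬ (λ (_ , semilength≡ , _) →
         <⇒≱ L<n (subst₂ _≤_ semilength≡ length≡ (semilength≤length w)))
      (avoidingSchroder? n P w)

sumWords-avoidingDyck-< : ∀ h P L → L < 2 * h → sumWords L (𝟙 ∘ avoidingDyck? h P) ≡ 0
sumWords-avoidingDyck-< h P L L<2h = sumWords-vanish L λ v length≡ →
  𝟙-¬ (λ (dyck , semilength≡ , _) →
         <-irrefl (trans (sym length≡) (length-dyck-semilength v dyck semilength≡)) L<2h)
      (avoidingDyck? h P v)
  where
  length-dyck-semilength : ∀ v → IsDyck v → semilength v ≡ h → length v ≡ 2 * h
  length-dyck-semilength v dyck refl =
    trans (length-dyck v dyck) (cong (semilength v +_) (sym (+-identityʳ _)))

d≡sumH2Free : ∀ h P → d h P ≡ sumH2Free (2 * h) (𝟙 ∘ avoidingDyck? h P)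
d≡sumH2Free h P = begin
  d h P
    ≡⟨ count-wordsUpTo (avoidingDyck? h P) (2 * h) ⟩
  sum (applyUpTo byLength (suc (2 * h)))
    ≡⟨ cong (sum ∘ applyUpTo byLength) (+-comm 1 (2 * h)) ⟩
  sum (applyUpTo byLength (2 * h + 1))
    ≡⟨ sum-applyUpTo-+ (2 * h) 1 byLength (sumWords-avoidingDyck-< h P) ⟩
  byLength (2 * h + 0) + 0
    ≡⟨ trans (+-identityʳ _) (cong byLength (+-identityʳ (2 * h))) ⟩
  byLength (2 * h)
    ≡⟨ sumWords-cong (2 * h) (λ v _ → dyck⇒noH2 v) ⟩
  sumH2Free (2 * h) (𝟙 ∘ avoidingDyck? h P) ∎
  where
  byLength : ℕ → ℕ
  byLength L = sumWords L (𝟙 ∘ avoidingDyck? h P)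
  dyck⇒noH2 : ∀ v → 𝟙 (avoidingDyck? h P v) ≡ 𝟙 (noH2? v) * 𝟙 (avoidingDyck? h P v)
  dyck⇒noH2 v = trans (𝟙-⇔ (λ x@((_ , noH2) , _) → noH2 , x) (λ (_ , x) → x)
                           (avoidingDyck? h P v) (noH2? v ×-dec avoidingDyck? h P v))
                      (𝟙-× (noH2? v) (avoidingDyck? h P v))

sumWords-avoidingSchroder : ∀ n h P → IsDyck P → h ≤ n →
  sumWords (n + h) (𝟙 ∘ avoidingSchroder? n P) ≡ ((n + h) C (n ∸ h)) * d h P
sumWords-avoidingSchroder n h P (_ , noH2) h≤n = begin
  sumWords (n + h) (𝟙 ∘ avoidingSchroder? n P)
    ≡⟨ sumWords-cong (n + h) (λ w length≡ → indicator≡ w length≡) ⟩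
  sumEraseH2 (n + h) k (𝟙 ∘ avoidingDyck? h P)
    ≡⟨ subst (λ L → sumEraseH2 L k G ≡ (L C k) * sumH2Free (2 * h) G)
             length≡ (sumEraseH2≡C*sumH2Free k (2 * h) G) ⟩
  ((n + h) C k) * sumH2Free (2 * h) G
    ≡⟨ cong (((n + h) C k) *_) (d≡sumH2Free h P) ⟨
  ((n + h) C k) * d h P ∎
  where
  k = n ∸ h
  G = 𝟙 ∘ avoidingDyck? h P
  indicator≡ : ∀ w → length w ≡ n + h →
    𝟙 (avoidingSchroder? n P w) ≡ 𝟙 (countH2 w ≟ k) * G (eraseH2 w)
  indicator≡ w length≡ =
    trans (𝟙-⇔ (λ x → eraseH2-avoidingDyck x length≡) (avoidingDyck-eraseH2 h≤n noH2)
               (avoidingSchroder? n P w) ((countH2 w ≟ k) ×-dec avoidingDyck? h P (eraseH2 w)))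
          (𝟙-× (countH2 w ≟ k) (avoidingDyck? h P (eraseH2 w)))
  length≡ : 2 * h + k ≡ n + h
  length≡ = begin
    (h + (h + 0)) + k  ≡⟨ cong (λ x → h + x + k) (+-identityʳ h) ⟩
    h + h + k          ≡⟨ +-assoc h h k ⟩
    h + (h + k)        ≡⟨ cong (h +_) (m+[n∸m]≡n h≤n) ⟩
    h + n              ≡⟨ +-comm h n ⟩
    n + h              ∎

mainTheorem3 : (P : Word) → IsDyck P → (n : ℕ) →
    s n P ≡ sum (map (λ h → ((n + h) C (n ∸ h)) * d h P) (upTo (n + 1)))
mainTheorem3 P dyck n = begin
  s n P
    ≡⟨ count-wordsUpTo (avoidingSchroder? n P) (2 * n) ⟩
  sum (applyUpTo byLength (suc (2 * n)))
    ≡⟨ cong (sum ∘ applyUpTo byLength) suc2n≡n+suc-n ⟩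
  sum (applyUpTo byLength (n + suc n))
    ≡⟨ sum-applyUpTo-+ n (suc n) byLength (sumWords-avoidingSchroder-< n P) ⟩
  sum (applyUpTo (λ h → byLength (n + h)) (suc n))
    ≡⟨ sum-applyUpTo-cong (suc n) (λ h h<1+n →
         sumWords-avoidingSchroder n h P dyck (≤-pred h<1+n)) ⟩
  sum (applyUpTo term (suc n))
    ≡⟨ cong (sum ∘ applyUpTo term) (+-comm 1 n) ⟩
  sum (applyUpTo term (n + 1))
    ≡⟨ cong sum (map-upTo term (n + 1)) ⟨
  sum (map term (upTo (n + 1))) ∎
  where
  byLength : ℕ → ℕ
  byLength L = sumWords L (𝟙 ∘ avoidingSchroder? n P)
  term : ℕ → ℕ
  term h = ((n + h) C (n ∸ h)) * d h P
  suc2n≡n+suc-n : suc (2 * n) ≡ n + suc n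
  suc2n≡n+suc-n = trans (cong (λ x → suc (n + x)) (+-identityʳ n)) (sym (+-suc n n))
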